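{- Let $M>0$ be an integer and let ${A}$ be a deterministic projective $M$-regular list update algorithm over a finite set $L$ of at least three list items (with a fixed initial list state), described by its state function $S$. Then there exists a function $F:U\to\mathbb{N}$ with $F(x^i)\le i$ for all $x^i\in U$ such that the following holds: for any two distinct items $x,y\in L$ and any request sequence $\sigma$ with $|\sigma_x|\ge M$ and $|\sigma_y|\ge M$, setting $q=F(\sigma_x)$ and $l=F(\sigma_y)$, we have $S_{xy}(\sigma)=[xy]$ if $x_{(q)}$ is requested after $y_{(l)}$ in $\sigma$, and $S_{xy}(\sigma)=[yx]$ if $x_{(q)}$ is requested before $y_{(l)}$ in $\sigma$.
   Context: List update problem: a list state is a linear order of the finite item set $L$, written $[x_1\ldots x_n]$ with $x_1$ at the front. A request sequence is a finite word over $L$. A deterministic algorithm with fixed initial list is identified with the function $S$ mapping each finite request sequence $\sigma$ to the list state $S(\sigma)$ after serving $\sigma$. For items $x,y$, $\sigma_{xy}$ (resp. $\sigma_x$) is the subsequence of $\sigma$ of requests to $x$ or $y$ (resp. to $x$), and $S_{xy}(\sigma)\in\{[xy],[yx]\}$ is the relative order of $x,y$ in $S(\sigma)$. The algorithm is projective if $S_{xy}(\sigma)=S_{xy}(\sigma_{xy})$ for all $x,y,\sigma$. It is $M$-regular if for every item $x$ and every request sequence $\sigma$, item $x$ is at the front of the list $S(\sigma x^M)$, where $x^M$ denotes $M$ consecutive requests to $x$. A unary projection $x^i$ is the sequence of $i\ge0$ requests to $x$; $U=\{x^i:x\in L,i\ge0\}$, with $x^0\ne y^0$ for $x\ne y$.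 If $\sigma_x=x^i$, $x_{(q)}$ is the $q$th request to $x$ in $\sigma$. -}

module Defs where

open import Data.Nat using (ℕ; suc; _≤_; _<_)
open import Data.Fin using (Fin; _≟_)
open import Data.List using (List; []; _∷_; _++_; filter; length; take; replicate)
open import Data.List.Membership.Propositional using (_∈_)
open import Data.List.Relation.Binary.Permutation.Propositional using (_↭_)
open import Data.Fin using () renaming (_≟_ to _≟ᶠ_)
open import Data.List using (allFin)
open import Data.Product using (Σ; ∃; ∃-syntax; _×_)
open import Relation.Nullary.Decidable using (_⊎-dec_)
open import Relation.Binary.PropositionalEquality using (_≡_; _≢_)
open import Function.Bundles using (_⇔_)

-- The item set L is Fin n.  A list state is a linear order of L, represented
-- as a list enumerating every item exactly once (a permutation of allFin n);
-- the head of the list is the front of the list.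
record ListState (n : ℕ) : Set where
  constructor listState
  field
    order : List (Fin n)
    isPerm : order ↭ allFin n
open ListState public

Request : ℕ → Set
Request n = List (Fin n)

Before : ∀ {n} → ListState n → Fin n → Fin n → Set
Before s x y = ∃[ as ] ∃[ bs ] (order s ≡ as ++ (x ∷ bs) × y ∈ bs)

AtFront : ∀ {n} → ListState n → Fin n → Set
AtFront s x = ∃[ rest ] (order s ≡ x ∷ rest)

proj₂ₓᵧ : ∀ {n} → Fin n → Fin n → Request n → Request n
proj₂ₓᵧ x y σ = filter (λ z → (z ≟ x) ⊎-dec (z ≟ y)) σ

-- |σ_x| : number of requests to x  (σ_x = x^(count x σ)).
count : ∀ {n} → Fin n → Request n → ℕ
count x σ = length (filter (λ z → z ≟ x) σ)

-- A deterministic algorithm with fixed initial list (S []) is a state function.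
StateFunction : ℕ → Set
StateFunction n = Request n → ListState n

-- Projective: S_xy(σ) = S_xy(σ_xy) for all distinct x, y and all σ.
-- (For distinct x, y, exactly one of Before s x y / Before s y x holds, so
--  equality of relative orders is the equivalence below.)
Projective : ∀ {n} → StateFunction n → Set
Projective {n} S = (x y : Fin n) (σ : Request n) → x ≢ y →
  Before (S σ) x y ⇔ Before (S (proj₂ₓᵧ x y σ)) x y

Regular : ∀ {n} → ℕ → StateFunction n → Set
Regular {n} M S = (x : Fin n) (σ : Request n) → AtFront (S (σ ++ replicate M x)) x

-- The request at (0-based) index k of σ is a request to x.
RequestAt : ∀ {n} → Request n → ℕ → Fin n → Set
RequestAt σ k x = ∃[ as ] ∃[ bs ] (σ ≡ as ++ (x ∷ bs) × length as ≡ k)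

-- x_(q): the q-th (1-based) request to x in σ is at index k of σ.
NthRequestAt : ∀ {n} → Request n → Fin n → ℕ → ℕ → Set
NthRequestAt σ x q k = RequestAt σ k x × suc (count x (take k σ)) ≡ q

-- For each item x fix a witness z ≠ x and let F x i be the least a such that z ends up
-- in front of x after the probe x^a z^M x^(i-a).  Everything rests on a splicing
-- argument: if σ = A B and z ∉ {x, y}, the sequence τ = A_xy z^M B_xy projects onto σ_xy,
-- onto the x-probe with the numbers of x in A and in B, and onto the y-probe with the
-- numbers of y in A and in B.  By projectivity the orders of x, z and of z, y in S(τ) are
-- those after the two probes, and they chain to the order of x, y in S(σ).  Cutting σ
-- right after y_(l), the y-probe puts z ahead of y by the choice of l = F(σ_y), and since
-- x_(q) comes later the x-probe stops before F(σ_x) and keeps x ahead of z.  Splicing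
-- A = x^a with B = v^M x^c also shows that the outcome of a probe ignores the witness.

module Submission where

open import Defs
open import Data.Nat using (ℕ; zero; suc; _+_; _∸_; _≤_; _<_; z≤n; s≤s)
open import Data.Nat.Properties
  using (≤-trans; n∸n≡0; m+n∸m≡n; m∸n+n≡m; +-suc; +-identityʳ; +-monoʳ-≤; module ≤-Reasoning)
open import Data.Fin using (Fin; zero; suc; _≟_)
open import Data.List using (List; []; _∷_; _++_; filter; length; take; drop; replicate)
open import Data.List.Properties
  using (++-assoc; ++-identityʳ; ∷-injective; filter-++; filter-idem; filter-all; filter-none; filter-≐;
         filter-accept; filter-reject; length-replicate; length-++; take++drop≡id)
open import Data.List.Membership.Propositional using (_∈_; _∉_)
open import Data.List.Membership.Propositional.Properties using (∈-∃++; ∈-++⁺ʳ; ∈-allFin)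
open import Data.List.Relation.Unary.Any using (here; there)
open import Data.List.Relation.Unary.AllPairs using (_∷_)
open import Data.List.Relation.Unary.All.Properties using (All¬⇒¬Any; replicate⁺)
open import Data.List.Relation.Unary.Unique.Propositional using (Unique)
open import Data.List.Relation.Unary.Unique.Propositional.Properties using (allFin⁺)
open import Data.List.Relation.Binary.Permutation.Propositional using (↭-sym; ↭⇒↭ₛ′)
open import Data.List.Relation.Binary.Permutation.Propositional.Properties using (∈-resp-↭)
import Data.List.Relation.Binary.Permutation.Setoid.Properties as Perm
open import Data.Product using (Σ; ∃-syntax; _×_; _,_; proj₁; proj₂)
open import Data.Sum using (_⊎_; inj₁; inj₂; [_,_]; swap)
open import Level using (Level)
open import Function.Bundles using (Equivalence)
open import Relation.Nullary using (¬_; Dec; yes; no; contradiction)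
open import Relation.Nullary.Decidable using (_⊎-dec_)
open import Relation.Unary using (Pred; Decidable)
open import Relation.Binary.PropositionalEquality hiding ([_])
open import Relation.Binary.PropositionalEquality.Properties using (setoid; isEquivalence)

module _ {a} {A : Set a} where

  Precedes : List A → A → A → Set a
  Precedes xs x y = ∃[ as ] ∃[ bs ] (xs ≡ as ++ x ∷ bs × y ∈ bs)

  unique-∉-after : ∀ as {x : A} {bs} → Unique (as ++ x ∷ bs) → x ∉ bs
  unique-∉-after []       (x∉bs ∷ _) = All¬⇒¬Any x∉bs
  unique-∉-after (_ ∷ as) (_ ∷ u)    = unique-∉-after as u

  unique-suffix : ∀ as cs {z : A} {ds es} → Unique (as ++ z ∷ ds) →
                  as ++ z ∷ ds ≡ cs ++ z ∷ es → ds ≡ es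
  unique-suffix []       []       _ eq = proj₂ (∷-injective eq)
  unique-suffix []       (c ∷ cs) {z} u eq with refl , eq′ ← ∷-injective eq =
    contradiction (subst (z ∈_) (sym eq′) (∈-++⁺ʳ cs (here refl))) (unique-∉-after [] u)
  unique-suffix (a ∷ as) []       {z} (a∉ ∷ _) eq with refl , _ ← ∷-injective eq =
    contradiction (∈-++⁺ʳ as (here refl)) (All¬⇒¬Any a∉)
  unique-suffix (_ ∷ as) (_ ∷ cs) (_ ∷ u) eq = unique-suffix as cs u (proj₂ (∷-injective eq))

  precedes-trans : ∀ {xs} → Unique xs → ∀ {x y z} → Precedes xs x z → Precedes xs z y → Precedes xs x y
  precedes-trans {xs} u {x} {y} {z} (as , bs , xs≡ , z∈bs) (cs , ds , xs≡′ , y∈ds)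
    with bs₁ , bs₂ , refl ← ∈-∃++ z∈bs =
    as , bs₁ ++ z ∷ bs₂ , xs≡ , ∈-++⁺ʳ bs₁ (there (subst (y ∈_) (sym bs₂≡ds) y∈ds))
    where
    xs≡″ : xs ≡ (as ++ x ∷ bs₁) ++ z ∷ bs₂
    xs≡″ = trans xs≡ (sym (++-assoc as (x ∷ bs₁) (z ∷ bs₂)))
    bs₂≡ds : bs₂ ≡ ds
    bs₂≡ds = unique-suffix (as ++ x ∷ bs₁) cs (subst Unique xs≡″ u) (trans (sym xs≡″) xs≡′)

  precedes-irrefl : ∀ {xs} → Unique xs → ∀ {x} → ¬ Precedes xs x x
  precedes-irrefl u (as , _ , refl , x∈bs) = unique-∉-after as u x∈bs

  precedes-total : ∀ xs {x y : A} → x ≢ y → x ∈ xs → y ∈ xs → Precedes xs x y ⊎ Precedes xs y x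
  precedes-total (_ ∷ xs) x≢y (here refl) (here refl) = contradiction refl x≢y
  precedes-total (_ ∷ xs) x≢y (here refl) (there y∈) = inj₁ ([] , xs , refl , y∈)
  precedes-total (_ ∷ xs) x≢y (there x∈) (here refl) = inj₂ ([] , xs , refl , x∈)
  precedes-total (a ∷ xs) x≢y (there x∈) (there y∈) with precedes-total xs x≢y x∈ y∈
  ... | inj₁ (as , bs , refl , p) = inj₁ (a ∷ as , bs , refl , p)
  ... | inj₂ (as , bs , refl , p) = inj₂ (a ∷ as , bs , refl , p)

module _ {n : ℕ} where

  unique-order : (s : ListState n) → Unique (order s)
  unique-order s =
    Perm.Unique-resp-↭ (setoid (Fin n)) (↭⇒↭ₛ′ isEquivalence (↭-sym (isPerm s))) (allFin⁺ n)

  ∈-order : (s : ListState n) (x : Fin n) → x ∈ order s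
  ∈-order s x = ∈-resp-↭ (↭-sym (isPerm s)) (∈-allFin x)

  before-trans : ∀ (s : ListState n) {x y z} → Before s x z → Before s z y → Before s x y
  before-trans s = precedes-trans (unique-order s)

  before-asym : ∀ (s : ListState n) {x y} → Before s x y → ¬ Before s y x
  before-asym s p q = precedes-irrefl (unique-order s) (before-trans s p q)

  before-total : ∀ (s : ListState n) {x y} → x ≢ y → Before s x y ⊎ Before s y x
  before-total s {x} {y} x≢y = precedes-total (order s) x≢y (∈-order s x) (∈-order s y)

  before? : ∀ (s : ListState n) x y → Dec (Before s x y)
  before? s x y with x ≟ y
  ... | yes refl = no (precedes-irrefl (unique-order s))
  ... | no x≢y with before-total s x≢y
  ...   | inj₁ x<y = yes x<y
  ...   | inj₂ y<x = no (before-asym s y<x)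

  ¬before⇒before : ∀ (s : ListState n) {x y} → x ≢ y → ¬ Before s y x → Before s x y
  ¬before⇒before s x≢y y≮x with before-total s x≢y
  ... | inj₁ x<y = x<y
  ... | inj₂ y<x = contradiction y<x y≮x

  atFront⇒before : ∀ (s : ListState n) {x y} → AtFront s x → x ≢ y → Before s x y
  atFront⇒before s {x} {y} (rest , s≡) x≢y with subst (y ∈_) s≡ (∈-order s y)
  ... | here refl = contradiction refl x≢y
  ... | there y∈rest = [] , rest , s≡ , y∈rest

module _ {n : ℕ} where

  private
    in? : (x y w : Fin n) → Dec ((w ≡ x) ⊎ (w ≡ y))
    in? x y w = (w ≟ x) ⊎-dec (w ≟ y)

  proj-comm : ∀ (x y : Fin n) σ → proj₂ₓᵧ x y σ ≡ proj₂ₓᵧ y x σ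
  proj-comm x y = filter-≐ (in? x y) (in? y x) (swap , swap)

  proj-++ : ∀ (x y : Fin n) σ ρ → proj₂ₓᵧ x y (σ ++ ρ) ≡ proj₂ₓᵧ x y σ ++ proj₂ₓᵧ x y ρ
  proj-++ x y = filter-++ (in? x y)

  proj-idem : ∀ (x y : Fin n) σ → proj₂ₓᵧ x y (proj₂ₓᵧ x y σ) ≡ proj₂ₓᵧ x y σ
  proj-idem x y = filter-idem (in? x y)

  proj-replicate-∈ : ∀ {x y w : Fin n} k → (w ≡ x) ⊎ (w ≡ y) →
                     proj₂ₓᵧ x y (replicate k w) ≡ replicate k w
  proj-replicate-∈ {x} {y} k w∈ = filter-all (in? x y) (replicate⁺ k w∈)

  proj-replicate-∉ : ∀ {x y w : Fin n} k → w ≢ x → w ≢ y → proj₂ₓᵧ x y (replicate k w) ≡ []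
  proj-replicate-∉ {x} {y} k w≢x w≢y = filter-none (in? x y) (replicate⁺ k [ w≢x , w≢y ])

  proj-∷-∈ : ∀ (x y : Fin n) {w} σ → (w ≡ x) ⊎ (w ≡ y) → proj₂ₓᵧ x y (w ∷ σ) ≡ w ∷ proj₂ₓᵧ x y σ
  proj-∷-∈ x y σ = filter-accept (in? x y)

  proj-∷-∉ : ∀ (x y : Fin n) {w} σ → w ≢ x → w ≢ y → proj₂ₓᵧ x y (w ∷ σ) ≡ proj₂ₓᵧ x y σ
  proj-∷-∉ x y σ w≢x w≢y = filter-reject (in? x y) [ w≢x , w≢y ]

  count-∷-≡ : ∀ (x : Fin n) σ → count x (x ∷ σ) ≡ suc (count x σ)
  count-∷-≡ x σ = cong length (filter-accept (_≟ x) refl)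

  count-∷-≢ : ∀ {x w : Fin n} σ → w ≢ x → count x (w ∷ σ) ≡ count x σ
  count-∷-≢ {x} σ w≢x = cong length (filter-reject (_≟ x) w≢x)

  proj-++₃ : ∀ (x y : Fin n) σ ρ υ →
             proj₂ₓᵧ x y (σ ++ ρ ++ υ) ≡ proj₂ₓᵧ x y σ ++ proj₂ₓᵧ x y ρ ++ proj₂ₓᵧ x y υ
  proj-++₃ x y σ ρ υ = trans (proj-++ x y σ (ρ ++ υ)) (cong (proj₂ₓᵧ x y σ ++_) (proj-++ x y ρ υ))

  proj-proj : ∀ {x y z : Fin n} → z ≢ y → ∀ σ → proj₂ₓᵧ x z (proj₂ₓᵧ x y σ) ≡ replicate (count x σ) x
  proj-proj z≢y [] = refl
  proj-proj {x} {y} {z} z≢y (w ∷ σ) = step (w ≟ x) (w ≟ y)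
    where
    open ≡-Reasoning
    step : Dec (w ≡ x) → Dec (w ≡ y) →
           proj₂ₓᵧ x z (proj₂ₓᵧ x y (w ∷ σ)) ≡ replicate (count x (w ∷ σ)) x
    step (yes refl) _ = begin
      proj₂ₓᵧ x z (proj₂ₓᵧ x y (x ∷ σ)) ≡⟨ cong (proj₂ₓᵧ x z) (proj-∷-∈ x y σ (inj₁ refl)) ⟩
      proj₂ₓᵧ x z (x ∷ proj₂ₓᵧ x y σ)   ≡⟨ proj-∷-∈ x z (proj₂ₓᵧ x y σ) (inj₁ refl) ⟩
      x ∷ proj₂ₓᵧ x z (proj₂ₓᵧ x y σ)   ≡⟨ cong (x ∷_) (proj-proj z≢y σ) ⟩
      replicate (suc (count x σ)) x     ≡⟨ cong (λ k → replicate k x) (count-∷-≡ x σ) ⟨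
      replicate (count x (x ∷ σ)) x     ∎
    step (no w≢x) (yes refl) = begin
      proj₂ₓᵧ x z (proj₂ₓᵧ x y (y ∷ σ)) ≡⟨ cong (proj₂ₓᵧ x z) (proj-∷-∈ x y σ (inj₂ refl)) ⟩
      proj₂ₓᵧ x z (y ∷ proj₂ₓᵧ x y σ)   ≡⟨ proj-∷-∉ x z (proj₂ₓᵧ x y σ) w≢x (≢-sym z≢y) ⟩
      proj₂ₓᵧ x z (proj₂ₓᵧ x y σ)       ≡⟨ proj-proj z≢y σ ⟩
      replicate (count x σ) x           ≡⟨ cong (λ k → replicate k x) (count-∷-≢ σ w≢x) ⟨
      replicate (count x (y ∷ σ)) x     ∎
    step (no w≢x) (no w≢y) = begin
      proj₂ₓᵧ x z (proj₂ₓᵧ x y (w ∷ σ)) ≡⟨ cong (proj₂ₓᵧ x z) (proj-∷-∉ x y σ w≢x w≢y) ⟩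
      proj₂ₓᵧ x z (proj₂ₓᵧ x y σ)       ≡⟨ proj-proj z≢y σ ⟩
      replicate (count x σ) x           ≡⟨ cong (λ k → replicate k x) (count-∷-≢ σ w≢x) ⟨
      replicate (count x (w ∷ σ)) x     ∎

  proj-proj′ : ∀ {x y z : Fin n} → z ≢ x → ∀ σ → proj₂ₓᵧ z y (proj₂ₓᵧ x y σ) ≡ replicate (count y σ) y
  proj-proj′ {x} {y} {z} z≢x σ =
    trans (proj-comm z y (proj₂ₓᵧ x y σ)) (trans (cong (proj₂ₓᵧ y z) (proj-comm x y σ)) (proj-proj z≢x σ))

  count-++ : ∀ (x : Fin n) σ ρ → count x (σ ++ ρ) ≡ count x σ + count x ρ
  count-++ x σ ρ = trans (cong length (filter-++ (_≟ x) σ ρ)) (length-++ (filter (_≟ x) σ))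

  count-replicate-≡ : ∀ (x : Fin n) k → count x (replicate k x) ≡ k
  count-replicate-≡ x k =
    trans (cong length (filter-all (_≟ x) (replicate⁺ k refl))) (length-replicate k)

  count-replicate-≢ : ∀ {x w : Fin n} k → w ≢ x → count x (replicate k w) ≡ 0
  count-replicate-≢ {x} k w≢x = cong length (filter-none (_≟ x) (replicate⁺ k w≢x))

  count-take-mono : ∀ (x : Fin n) σ {m k} → m ≤ k → count x (take m σ) ≤ count x (take k σ)
  count-take-mono x σ       {zero}          _         = z≤n
  count-take-mono x []      {suc m} {suc k} _         = z≤n
  count-take-mono x (w ∷ σ) {suc m} {suc k} (s≤s m≤k) = begin
    count x (w ∷ take m σ)                ≡⟨ count-++ x (w ∷ []) (take m σ) ⟩
    count x (w ∷ []) + count x (take m σ) ≤⟨ +-monoʳ-≤ (count x (w ∷ [])) (count-take-mono x σ m≤k) ⟩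
    count x (w ∷ []) + count x (take k σ) ≡⟨ count-++ x (w ∷ []) (take k σ) ⟨
    count x (w ∷ take k σ)                ∎
    where open ≤-Reasoning

  count-take-suc : ∀ as {x : Fin n} {bs} →
    count x (take (suc (length as)) (as ++ x ∷ bs)) ≡ suc (count x (take (length as) (as ++ x ∷ bs)))
  count-take-suc [] {x} = count-∷-≡ x []
  count-take-suc (w ∷ as) {x} {bs} = begin
    count x (w ∷ take (suc k) σ)          ≡⟨ count-++ x (w ∷ []) (take (suc k) σ) ⟩
    count x (w ∷ []) + count x (take (suc k) σ) ≡⟨ cong (count x (w ∷ []) +_) (count-take-suc as) ⟩
    count x (w ∷ []) + suc (count x (take k σ)) ≡⟨ +-suc (count x (w ∷ [])) (count x (take k σ)) ⟩
    suc (count x (w ∷ []) + count x (take k σ)) ≡⟨ cong suc (count-++ x (w ∷ []) (take k σ)) ⟨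
    suc (count x (w ∷ take k σ))          ∎
    where
    open ≡-Reasoning
    k = length as
    σ = as ++ x ∷ bs

  count-take-suc-at : ∀ {σ k} {x : Fin n} → RequestAt σ k x →
                      count x (take (suc k) σ) ≡ suc (count x (take k σ))
  count-take-suc-at (as , _ , refl , refl) = count-take-suc as

replicate-+ : ∀ {a} {A : Set a} m n (x : A) → replicate (m + n) x ≡ replicate m x ++ replicate n x
replicate-+ zero    n x = refl
replicate-+ (suc m) n x = cong (x ∷_) (replicate-+ m n x)

private
  variable
    p : Level
    P : Pred ℕ p

-- The least a < i satisfying P, or i if there is none.
least : Decidable P → ℕ → ℕ
least P? zero = zero
least P? (suc i) with P? zero
... | yes _ = zero
... | no  _ = suc (least (λ a → P? (suc a)) i)

least-≤ : ∀ (P? : Decidable P) i → least P? i ≤ i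
least-≤ P? zero = z≤n
least-≤ P? (suc i) with P? zero
... | yes _ = z≤n
... | no  _ = s≤s (least-≤ (λ a → P? (suc a)) i)

least-minimal : ∀ (P? : Decidable P) i {a} → a < least P? i → ¬ P a
least-minimal P? (suc i) {a} a<least with P? zero
least-minimal P? (suc i) {zero}  _           | no ¬P0 = ¬P0
least-minimal P? (suc i) {suc a} (s≤s a<least) | no _ = least-minimal (λ a → P? (suc a)) i a<least

least-satisfies : ∀ (P? : Decidable P) i → P i → P (least P? i)
least-satisfies P? zero    Pi = Pi
least-satisfies P? (suc i) Pi with P? zero
... | yes P0 = P0
... | no  _  = least-satisfies (λ a → P? (suc a)) i Pi

least-pos : ∀ (P? : Decidable P) i → ¬ P 0 → 0 < least P? (suc i)
least-pos P? i ¬P0 with P? zero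
... | yes P0 = contradiction P0 ¬P0
... | no  _  = s≤s z≤n

avoid₂ : ∀ {m} (x y : Fin (3 + m)) → ∃[ z ] z ≢ x × z ≢ y
avoid₂ zero          zero          = suc zero , (λ ()) , (λ ())
avoid₂ zero          (suc zero)    = suc (suc zero) , (λ ()) , (λ ())
avoid₂ zero          (suc (suc _)) = suc zero , (λ ()) , (λ ())
avoid₂ (suc zero)    zero          = suc (suc zero) , (λ ()) , (λ ())
avoid₂ (suc (suc _)) zero          = suc zero , (λ ()) , (λ ())
avoid₂ (suc _)       (suc _)       = zero , (λ ()) , (λ ())

module Construction {n : ℕ} (avoid : (x y : Fin n) → ∃[ z ] z ≢ x × z ≢ y)
                    (M : ℕ) (S : StateFunction n) (projective : Projective S) (regular : Regular M S) where

  project : ∀ {x y : Fin n} {σ} → x ≢ y → Before (S σ) x y → Before (S (proj₂ₓᵧ x y σ)) x y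
  project {x} {y} {σ} x≢y = Equivalence.to (projective x y σ x≢y)

  unproject : ∀ {x y : Fin n} {σ ρ} → x ≢ y → proj₂ₓᵧ x y σ ≡ ρ → Before (S ρ) x y → Before (S σ) x y
  unproject {x} {y} {σ} x≢y refl = Equivalence.from (projective x y σ x≢y)

  probe : Fin n → Fin n → ℕ → ℕ → Request n
  probe x z a c = replicate a x ++ replicate M z ++ replicate c x

  Overtakes : Fin n → Fin n → ℕ → ℕ → Set
  Overtakes x z a c = Before (S (probe x z a c)) z x

  overtakes-at-end : ∀ {x z} a → z ≢ x → Overtakes x z a 0
  overtakes-at-end {x} {z} a z≢x =
    subst (λ ρ → Before (S ρ) z x) (sym (cong (replicate a x ++_) (++-identityʳ (replicate M z))))
          (atFront⇒before (S _) (regular z (replicate a x)) z≢x)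

  not-overtaken-at-start : ∀ {x z} d → x ≢ z → Before (S (probe x z 0 (d + M))) x z
  not-overtaken-at-start {x} {z} d x≢z =
    subst (λ ρ → Before (S ρ) x z) probe≡
          (atFront⇒before (S _) (regular x (replicate M z ++ replicate d x)) x≢z)
    where
    probe≡ : (replicate M z ++ replicate d x) ++ replicate M x ≡ probe x z 0 (d + M)
    probe≡ = trans (++-assoc (replicate M z) (replicate d x) (replicate M x))
                   (cong (replicate M z ++_) (sym (replicate-+ d M x)))

  splice : ∀ {x y z} → x ≢ y → z ≢ x → z ≢ y → ∀ A B →
           Before (S (probe x z (count x A) (count x B))) x z →
           Overtakes y z (count y A) (count y B) →
           Before (S (A ++ B)) x y
  splice {x} {y} {z} x≢y z≢x z≢y A B x<z z<y =
    unproject x≢y (sym x-vs-y) (project x≢y (before-trans (S τ) x<z-in-τ z<y-in-τ))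
    where
    τ : Request n
    τ = proj₂ₓᵧ x y A ++ replicate M z ++ proj₂ₓᵧ x y B

    x-vs-z : proj₂ₓᵧ x z τ ≡ probe x z (count x A) (count x B)
    x-vs-z = trans (proj-++₃ x z (proj₂ₓᵧ x y A) (replicate M z) (proj₂ₓᵧ x y B))
      (cong₂ _++_ (proj-proj z≢y A) (cong₂ _++_ (proj-replicate-∈ M (inj₂ refl)) (proj-proj z≢y B)))

    z-vs-y : proj₂ₓᵧ z y τ ≡ probe y z (count y A) (count y B)
    z-vs-y = trans (proj-++₃ z y (proj₂ₓᵧ x y A) (replicate M z) (proj₂ₓᵧ x y B))
      (cong₂ _++_ (proj-proj′ z≢x A) (cong₂ _++_ (proj-replicate-∈ M (inj₁ refl)) (proj-proj′ z≢x B)))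

    x-vs-y : proj₂ₓᵧ x y τ ≡ proj₂ₓᵧ x y (A ++ B)
    x-vs-y = trans (proj-++₃ x y (proj₂ₓᵧ x y A) (replicate M z) (proj₂ₓᵧ x y B))
      (trans (cong₂ _++_ (proj-idem x y A) (cong₂ _++_ (proj-replicate-∉ M z≢x z≢y) (proj-idem x y B)))
             (sym (proj-++ x y A B)))

    x<z-in-τ : Before (S τ) x z
    x<z-in-τ = unproject (≢-sym z≢x) x-vs-z x<z

    z<y-in-τ : Before (S τ) z y
    z<y-in-τ = unproject z≢y z-vs-y z<y

  overtakes-resp-witness : ∀ {x u v} → u ≢ x → v ≢ x → ∀ {a c} → Overtakes x u a c → Overtakes x v a c
  overtakes-resp-witness {x} {u} {v} u≢x v≢x {a} {c} u<x with u ≟ v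
  ... | yes refl = u<x
  ... | no u≢v = splice v≢x u≢v u≢x (replicate a x) (replicate M v ++ replicate c x) v<u u<x′
    where
    v<u : Before (S (probe v u (count v (replicate a x)) (count v (replicate M v ++ replicate c x)))) v u
    v<u rewrite count-replicate-≢ a (≢-sym v≢x) | count-++ v (replicate M v) (replicate c x)
              | count-replicate-≡ v M | count-replicate-≢ c (≢-sym v≢x) | +-identityʳ M
      = not-overtaken-at-start 0 (≢-sym u≢v)
    u<x′ : Overtakes x u (count x (replicate a x)) (count x (replicate M v ++ replicate c x))
    u<x′ rewrite count-replicate-≡ x a | count-++ x (replicate M v) (replicate c x)
               | count-replicate-≢ M v≢x | count-replicate-≡ x c
      = u<x

  witness : Fin n → Fin n
  witness x = proj₁ (avoid x x)

  witness≢ : ∀ x → witness x ≢ x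
  witness≢ x = proj₁ (proj₂ (avoid x x))

  overtaken? : ∀ x i → Decidable (λ a → Overtakes x (witness x) a (i ∸ a))
  overtaken? x i a = before? (S (probe x (witness x) a (i ∸ a))) (witness x) x

  F : Fin n → ℕ → ℕ
  F x i = least (overtaken? x i) i

  F-≤ : ∀ x i → F x i ≤ i
  F-≤ x i = least-≤ (overtaken? x i) i

  F-pos : 1 ≤ M → ∀ x i → M ≤ i → 1 ≤ F x i
  F-pos 1≤M x zero    M≤0 = contradiction (≤-trans 1≤M M≤0) λ ()
  F-pos 1≤M x (suc i) M≤i = least-pos (overtaken? x (suc i)) i (before-asym (S _) x<w)
    where
    x<w : Before (S (probe x (witness x) 0 (suc i))) x (witness x)
    x<w = subst (λ c → Before (S (probe x (witness x) 0 c)) x (witness x)) (m∸n+n≡m M≤i)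
                (not-overtaken-at-start (suc i ∸ M) (≢-sym (witness≢ x)))

  F-below : ∀ x {a c} → a < F x (a + c) → Before (S (probe x (witness x) a c)) x (witness x)
  F-below x {a} {c} a<F = ¬before⇒before (S _) (≢-sym (witness≢ x)) w≮x
    where
    w≮x : ¬ Overtakes x (witness x) a c
    w≮x = subst (λ d → ¬ Overtakes x (witness x) a d) (m+n∸m≡n a c)
                (least-minimal (overtaken? x (a + c)) (a + c) a<F)

  F-at : ∀ x {b d} → F x (b + d) ≡ b → Overtakes x (witness x) b d
  F-at x {b} {d} F≡b = subst (Overtakes x (witness x) b) (m+n∸m≡n b d)
    (subst (λ a → Overtakes x (witness x) a (b + d ∸ a)) F≡b
           (least-satisfies (overtaken? x (b + d)) (b + d) w<x))
    where
    w<x : Overtakes x (witness x) (b + d) (b + d ∸ (b + d))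
    w<x = subst (Overtakes x (witness x) (b + d)) (sym (n∸n≡0 (b + d)))
                (overtakes-at-end (b + d) (witness≢ x))

  before-by-rank : ∀ {x y} → x ≢ y → ∀ A B {σ} → A ++ B ≡ σ →
                   count x A < F x (count x σ) → count y A ≡ F y (count y σ) → Before (S σ) x y
  before-by-rank {x} {y} x≢y A B refl x-behind y-reached = splice x≢y z≢x z≢y A B x<z z<y
    where
    z = proj₁ (avoid x y)
    z≢x = proj₁ (proj₂ (avoid x y))
    z≢y = proj₂ (proj₂ (avoid x y))

    x<z : Before (S (probe x z (count x A) (count x B))) x z
    x<z = ¬before⇒before (S _) (≢-sym z≢x) λ z<x →
      before-asym (S _) (F-below x (subst (λ i → count x A < F x i) (count-++ x A B) x-behind))
                        (overtakes-resp-witness z≢x (witness≢ x) {count x A} {count x B} z<x)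

    z<y : Overtakes y z (count y A) (count y B)
    z<y = overtakes-resp-witness (witness≢ y) z≢y {count y A} {count y B}
            (F-at y (trans (cong (F y) (sym (count-++ y A B))) (sym y-reached)))

  later-rank-first : ∀ {x y} σ → x ≢ y → ∀ {kx ky} →
                     NthRequestAt σ x (F x (count x σ)) kx → NthRequestAt σ y (F y (count y σ)) ky →
                     ky < kx → Before (S σ) x y
  later-rank-first {x} {y} σ x≢y {kx} {ky} (_ , x-rank) (y-at , y-rank) ky<kx =
    before-by-rank x≢y (take (suc ky) σ) (drop (suc ky) σ) (take++drop≡id (suc ky) σ)
      (subst (count x (take (suc ky) σ) <_) x-rank (s≤s (count-take-mono x σ ky<kx)))
      (trans (count-take-suc-at y-at) y-rank)

theorem12 : (n : ℕ) → 3 ≤ n → (M : ℕ) → 1 ≤ M → (S : StateFunction n) →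
    Projective S → Regular M S →
    Σ (Fin n → ℕ → ℕ) λ F →
      ((x : Fin n) (i : ℕ) → F x i ≤ i)
      × ((x : Fin n) (i : ℕ) → M ≤ i → 1 ≤ F x i)
      × ((x y : Fin n) (σ : Request n) → x ≢ y →
           M ≤ count x σ → M ≤ count y σ →
           (kx ky : ℕ) →
           NthRequestAt σ x (F x (count x σ)) kx →
           NthRequestAt σ y (F y (count y σ)) ky →
           (ky < kx → Before (S σ) x y) × (kx < ky → Before (S σ) y x))
theorem12 (suc (suc (suc _))) (s≤s (s≤s (s≤s z≤n))) M 1≤M S projective regular =
  F , F-≤ , F-pos 1≤M , λ x y σ x≢y _ _ _ _ x-nth y-nth →
    later-rank-first σ x≢y x-nth y-nth , later-rank-first σ (≢-sym x≢y) y-nth x-nth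
  where open Construction avoid₂ M S projective regular
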